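{- Let $I$ be a $Q$-interval of $\mathcal{P}$ with domain $D(I)=\{x_1,\ldots,x_r\}$ such that $I$ is a $b$-nested common interval. Then at most one of the intervals $\mathrm{Int}(x_i)$, $1\le i\le r$, is $b$-large, and if such an interval exists, it is a $b$-nested common interval.
   Context: Let $n,K\geq 1$ and let $\mathcal{P}=\{P_1,\ldots,P_K\}$ be a set of permutations of $\{1,\ldots,n\}$ with $P_1=\mathrm{Id}_n$. For $i\le j$, $(i..j)=\{i,\ldots,j\}$. A common interval of $\mathcal{P}$ is a set of integers occupying consecutive positions in every $P_k$; every common interval has the form $(i..j)$. Fix a positive integer $b$. A common interval $I$ is $b$-nested if $|I|=1$ or $I$ strictly contains a $b$-nested common interval $J$ with $|J|\geq|I|-b$; it is $b$-small if $|I|\le b$ and $b$-large otherwise. Two intervals $(i..j)$, $(k..l)$ overlap if $i<k\le j<l$ or $k<i\le l<j$. A common interval is strong if it overlaps no other common interval. Let $T$ be the inclusion tree of strong common intervals (nodes $x$ correspond bijectively to strong common intervals $\mathrm{Int}(x)$, root $(1..n)$, $x$ parent of $y$ iff $\mathrm{Int}(x)$ is the smallest strong common interval strictly containing $\mathrm{Int}(y)$). A node $x$ with children set $D$ is labeled $P$ if for every $D'\subset D$ with $2\le|D'|<|D|$ the union of $\mathrm{Int}(z)$, $z\in D'$, is not a common interval; otherwise $Q$. The children of a $Q$-node are ordered $y_1,\ldots,y_r$ with $\max(\mathrm{Int}(y_i))+1=\min(\mathrm{Int}(y_{i+1}))$. It is known that every common interval $I$ is either strong or equals $\bigcup_{h=l}^m\mathrm{Int}(z_h)$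 for consecutive children $z_l,\ldots,z_m$ of a unique $Q$-node. The domain $D(I)$ is the set of children of the node of $I$ if $I$ is strong, and $\{z_l,\ldots,z_m\}$ otherwise. A $P$-interval is a strong common interval whose node is labeled $P$; every other common interval is a $Q$-interval. -}

module Defs where

open import Data.Nat using (ℕ; zero; suc; _+_; _∸_; _≤_; _<_)
open import Data.Fin using (Fin; toℕ)
open import Data.Product using (Σ; ∃; _×_; _,_; proj₁; proj₂)
open import Data.Sum using (_⊎_)
open import Data.List using (List; length)
open import Data.List.Relation.Unary.Any using (Any)
open import Data.List.Relation.Unary.All using (All)
open import Data.List.Relation.Unary.Unique.Propositional using (Unique)
open import Data.List.Membership.Propositional using (_∉_)
open import Function.Bundles using (_↔_; Inverse)
open import Relation.Nullary using (¬_)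
open import Relation.Binary.PropositionalEquality using (_≡_; _≢_)

-- Conventions: elements and positions are 0-indexed, i.e. {0,…,n-1}
-- instead of {1,…,n}.  A permutation is a bijection Fin n ↔ Fin n whose
-- forward map sends a position p to the element P(p) at that position.
Perm : ℕ → Set
Perm n = Fin n ↔ Fin n

_⟺_ : Set → Set → Set
A ⟺ B = (A → B) × (B → A)

Interval : Set
Interval = ℕ × ℕ

_∈I_ : ℕ → Interval → Set
e ∈I (i , j) = i ≤ e × e ≤ j

size : Interval → ℕ
size (i , j) = suc (j ∸ i)

_⊆I_ : Interval → Interval → Set
(k , l) ⊆I (i , j) = i ≤ k × l ≤ j

_⊂I_ : Interval → Interval → Set
J ⊂I I = J ⊆I I × J ≢ I

Overlap : Interval → Interval → Set
Overlap (i , j) (k , l) = (i < k × k ≤ j × j < l) ⊎ (k < i × i ≤ l × l < j)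

module _ (n K : ℕ) (P : Fin K → Perm n) where

  -- (i..j) is a common interval: it occupies consecutive positions
  -- a, …, a+(j-i) in every P_k.
  Common : Interval → Set
  Common (i , j) = i ≤ j × j < n ×
    ((k : Fin K) → ∃ λ a → (p : Fin n) →
       (a ≤ toℕ p × toℕ p ≤ a + (j ∸ i))
         ⟺ ((i , j) ∋ toℕ (Inverse.to (P k) p)))
    where
    _∋_ : Interval → ℕ → Set
    I ∋ e = e ∈I I

  Strong : Interval → Set
  Strong I = Common I × ((J : Interval) → Common J → ¬ Overlap I J)

  Child : Interval → Interval → Set
  Child x y = Strong x × Strong y × y ⊂I x ×
    ((z : Interval) → Strong z → y ⊂I z → x ⊆I z)

  UnionCommon : List Interval → Set
  UnionCommon D' = ∃ λ c → Common c ×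
    ((e : ℕ) → (e ∈I c) ⟺ Any (λ z → e ∈I z) D')

  -- Subsets D' ⊆ D are given as
  -- duplicate-free lists of children; |D'| < |D| means some child is
  -- missing from D'.
  PLabel : Interval → Set
  PLabel x = (D' : List Interval) → Unique D' → All (Child x) D' →
    2 ≤ length D' → (∃ λ z → Child x z × z ∉ D') → ¬ UnionCommon D'

  QNode : Interval → Set
  QNode x = Strong x × ¬ PLabel x

  PInterval : Interval → Set
  PInterval I = Strong I × PLabel I

  QInterval : Interval → Set
  QInterval I = Common I × ¬ PInterval I

  -- x ∈ D(I): if I is strong, x is a child of I; otherwise x is one of the
  -- children z_l,…,z_m of a Q-node y whose union is I.
  InDomain : Interval → Interval → Set
  InDomain I x =
    (Strong I × Child I x) ⊎
    (¬ Strong I × ∃ λ y → QNode y × Child y x × x ⊆I I ×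
       ((e : ℕ) → e ∈I I → ∃ λ z → Child y z × z ⊆I I × e ∈I z))

  module _ (b : ℕ) where

    data Nested : Interval → Set where
      single : ∀ {I} → Common I → size I ≡ 1 → Nested I
      grow   : ∀ {I} J → Common I → Common J → J ⊂I I →
               size I ∸ b ≤ size J → Nested J → Nested I

    Large : Interval → Set
    Large I = b < size I

-- Inside a b-nested common interval J with nesting step J′ ⊂ J, |J| ≤ |J′| + b,
-- a b-large interval cannot be disjoint from J′: their sizes would add up to
-- more than |J|.  A strong interval never overlaps J′, so a b-large strong
-- x ⊆ J either contains J′ (and is then b-nested through J′) or lies inside J′
-- (and we descend the nesting chain).  Two disjoint b-large strong intervals
-- can therefore never both sit inside J.  Finally the elements of D(I) are
-- strong and pairwise disjoint, since a strong interval strictly above one of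
-- them contains all of I.
module Submission where

open import Defs
open import Data.Nat using (ℕ; _≤_; _<_; _+_; _∸_; suc; s≤s)
open import Data.Nat.Properties
open import Data.Fin using (Fin; fromℕ<)
open import Data.Product using (_×_; _,_; proj₁; proj₂)
open import Data.Product.Properties using (≡-dec)
open import Data.Sum using (_⊎_; inj₁; inj₂)
open import Data.Empty using (⊥-elim)
open import Relation.Nullary using (¬_; Dec; yes; no)
open import Relation.Binary.PropositionalEquality
  using (_≡_; _≢_; refl; sym; cong; cong₂; subst)
open import Function using (_∘_)
open import Function.Bundles using (Inverse)

NonEmpty : Interval → Set
NonEmpty (i , j) = i ≤ j

Disjoint : Interval → Interval → Set
Disjoint (i , j) (k , l) = j < k ⊎ l < i

_≟I_ : (A B : Interval) → Dec (A ≡ B)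
_≟I_ = ≡-dec _≟_ _≟_

∈I-⊆ : ∀ {e A B} → e ∈I A → A ⊆I B → e ∈I B
∈I-⊆ (ie , ej) (ki , jl) = ≤-trans ki ie , ≤-trans ej jl

⊆I-trans : ∀ {A B C} → A ⊆I B → B ⊆I C → A ⊆I C
⊆I-trans (p , q) (r , s) = ≤-trans r p , ≤-trans q s

⊆I-antisym : ∀ {A B} → A ⊆I B → B ⊆I A → A ≡ B
⊆I-antisym (p , q) (r , s) = cong₂ _,_ (≤-antisym r p) (≤-antisym q s)

Disjoint-sym : ∀ A B → Disjoint A B → Disjoint B A
Disjoint-sym _ _ (inj₁ p) = inj₂ p
Disjoint-sym _ _ (inj₂ p) = inj₁ p

Disjoint-⊆ˡ : ∀ A X Y → A ⊆I X → Disjoint X Y → Disjoint A Y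
Disjoint-⊆ˡ _ _ _ (_ , cj) (inj₁ p) = inj₁ (≤-<-trans cj p)
Disjoint-⊆ˡ _ _ _ (ia , _) (inj₂ p) = inj₂ (<-≤-trans p ia)

nonOverlapping-trichotomy : ∀ A B → ¬ Overlap A B →
  B ⊆I A ⊎ A ⊆I B ⊎ Disjoint A B
nonOverlapping-trichotomy (i , j) (k , l) nov with <-≤-connex i k
... | inj₁ i<k with <-≤-connex j k
...   | inj₁ j<k = inj₂ (inj₂ (inj₁ j<k))
...   | inj₂ k≤j with <-≤-connex j l
...     | inj₁ j<l = ⊥-elim (nov (inj₁ (i<k , k≤j , j<l)))
...     | inj₂ l≤j = inj₁ (<⇒≤ i<k , l≤j)
nonOverlapping-trichotomy (i , j) (k , l) nov | inj₂ k≤i with m≤n⇒m<n∨m≡n k≤i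
... | inj₂ refl with ≤-total l j
...   | inj₁ l≤j = inj₁ (≤-refl , l≤j)
...   | inj₂ j≤l = inj₂ (inj₁ (≤-refl , j≤l))
nonOverlapping-trichotomy (i , j) (k , l) nov | inj₂ k≤i | inj₁ k<i with <-≤-connex l i
... | inj₁ l<i = inj₂ (inj₂ (inj₂ l<i))
... | inj₂ i≤l with <-≤-connex l j
...   | inj₁ l<j = ⊥-elim (nov (inj₂ (k<i , i≤l , l<j)))
...   | inj₂ j≤l = inj₂ (inj₁ (k≤i , j≤l))

size+start : ∀ {i j} → i ≤ j → size (i , j) + i ≡ suc j
size+start i≤j = cong suc (m∸n+n≡m i≤j)

size-mono : ∀ A B → NonEmpty A → NonEmpty B → A ⊆I B → size A ≤ size B
size-mono (a , c) (i , j) na nb (ia , cj) = +-cancelʳ-≤ a _ _ (begin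
    size (a , c) + a  ≡⟨ size+start na ⟩
    suc c             ≤⟨ s≤s cj ⟩
    suc j             ≡⟨ sym (size+start nb) ⟩
    size (i , j) + i  ≤⟨ +-monoʳ-≤ (size (i , j)) ia ⟩
    size (i , j) + a  ∎)
  where open ≤-Reasoning

size-+-before : ∀ A B C → NonEmpty A → NonEmpty B → NonEmpty C →
  A ⊆I C → B ⊆I C → proj₂ A < proj₁ B → size A + size B ≤ size C
size-+-before (a , c) (k , l) (i , j) na nb nc (ia , _) (_ , lj) c<k =
  +-cancelʳ-≤ a _ _ (begin
    sA + sB + a    ≡⟨ +-assoc sA sB a ⟩
    sA + (sB + a)  ≡⟨ cong (sA +_) (+-comm sB a) ⟩
    sA + (a + sB)  ≡⟨ sym (+-assoc sA a sB) ⟩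
    sA + a + sB    ≡⟨ cong (_+ sB) (size+start na) ⟩
    suc c + sB     ≤⟨ +-monoˡ-≤ sB c<k ⟩
    k + sB         ≡⟨ +-comm k sB ⟩
    sB + k         ≡⟨ size+start nb ⟩
    suc l          ≤⟨ s≤s lj ⟩
    suc j          ≡⟨ sym (size+start nc) ⟩
    sC + i         ≤⟨ +-monoʳ-≤ sC ia ⟩
    sC + a         ∎)
  where
  open ≤-Reasoning
  sA = size (a , c)
  sB = size (k , l)
  sC = size (i , j)

size-+-disjoint : ∀ A B C → NonEmpty A → NonEmpty B → NonEmpty C →
  A ⊆I C → B ⊆I C → Disjoint A B → size A + size B ≤ size C
size-+-disjoint A B C na nb nc AC BC (inj₁ p) = size-+-before A B C na nb nc AC BC p
size-+-disjoint A B C na nb nc AC BC (inj₂ p) =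
  subst (_≤ size C) (+-comm (size B) (size A)) (size-+-before B A C nb na nc BC AC p)

large-⊆-step⇒¬Disjoint : ∀ b x J′ J → NonEmpty x → NonEmpty J′ → NonEmpty J →
  J′ ⊆I J → size J ∸ b ≤ size J′ → b < size x → x ⊆I J → ¬ Disjoint x J′
large-⊆-step⇒¬Disjoint b x J′ J nx nJ′ nJ J′J step large xJ d =
  <-irrefl refl (begin-strict
    size J                ≤⟨ m≤n+m∸n (size J) b ⟩
    b + (size J ∸ b)      ≤⟨ +-monoʳ-≤ b step ⟩
    b + size J′           <⟨ +-monoˡ-< (size J′) large ⟩
    size x + size J′      ≤⟨ size-+-disjoint x J′ J nx nJ′ nJ xJ J′J d ⟩
    size J                ∎)
  where open ≤-Reasoning

module _ (n K : ℕ) (P : Fin K → Perm n) where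

  Common⇒NonEmpty : ∀ {A} → Common n K P A → NonEmpty A
  Common⇒NonEmpty = proj₁

  Strong⇒NonEmpty : ∀ {A} → Strong n K P A → NonEmpty A
  Strong⇒NonEmpty = proj₁ ∘ proj₁

  strong-trichotomy : ∀ x y → Strong n K P x → Common n K P y →
    y ⊆I x ⊎ x ⊆I y ⊎ Disjoint x y
  strong-trichotomy x y sx cy = nonOverlapping-trichotomy x y (proj₂ sx y cy)

  InDomain⇒Strong : ∀ {I x} → InDomain n K P I x → Strong n K P x
  InDomain⇒Strong (inj₁ (_ , _ , sx , _)) = sx
  InDomain⇒Strong (inj₂ (_ , _ , _ , (_ , sx , _) , _)) = sx

  InDomain⇒⊆I : ∀ {I x} → InDomain n K P I x → x ⊆I I
  InDomain⇒⊆I (inj₁ (_ , _ , _ , (xI , _) , _)) = xI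
  InDomain⇒⊆I (inj₂ (_ , _ , _ , _ , xI , _)) = xI

  -- By minimality of the parent node, a strong interval strictly above a
  -- domain element contains the parent, hence all the siblings covering I.
  InDomain-⊂I-Strong⇒⊇ : ∀ {I x y} → Common n K P I → InDomain n K P I x →
    Strong n K P y → x ⊂I y → I ⊆I y
  InDomain-⊂I-Strong⇒⊇ _ (inj₁ (_ , (_ , _ , _ , minimal))) sy xy = minimal _ sy xy
  InDomain-⊂I-Strong⇒⊇ {i , j} {y = y} cI (inj₂ (_ , _ , _ , (_ , _ , _ , minimal) , _ , cover))
    sy xy = proj₁ (covered (≤-refl , i≤j)) , proj₂ (covered (i≤j , ≤-refl))
    where
    i≤j = Common⇒NonEmpty cI
    covered : ∀ {e} → e ∈I (i , j) → e ∈I y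
    covered e∈I with cover _ e∈I
    ... | z , (_ , _ , (zp , _) , _) , _ , e∈z =
      ∈I-⊆ e∈z (⊆I-trans zp (minimal _ sy xy))

  InDomain-antichain : ∀ {I x y} → Common n K P I →
    InDomain n K P I x → InDomain n K P I y → ¬ x ⊂I y
  InDomain-antichain cI dx dy xy with
    ⊆I-antisym (InDomain⇒⊆I dy) (InDomain-⊂I-Strong⇒⊇ cI dx (InDomain⇒Strong dy) xy)
  InDomain-antichain cI dx (inj₁ (_ , _ , _ , (_ , y≢I) , _)) xy | y≡I = y≢I y≡I
  InDomain-antichain cI dx dy@(inj₂ (¬sI , _)) xy | y≡I =
    ¬sI (subst (Strong n K P) y≡I (InDomain⇒Strong dy))

  InDomain-Disjoint : ∀ {I x y} → Common n K P I →
    InDomain n K P I x → InDomain n K P I y → x ≢ y → Disjoint x y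
  InDomain-Disjoint {x = x} {y} cI dx dy x≢y
    with strong-trichotomy x y (InDomain⇒Strong dx) (proj₁ (InDomain⇒Strong dy))
  ... | inj₁ yx = ⊥-elim (InDomain-antichain cI dy dx (yx , x≢y ∘ sym))
  ... | inj₂ (inj₁ xy) = ⊥-elim (InDomain-antichain cI dx dy (xy , x≢y))
  ... | inj₂ (inj₂ d) = d

  Nested⇒Common : ∀ {b J} → Nested n K P b J → Common n K P J
  Nested⇒Common (single cJ _) = cJ
  Nested⇒Common (grow _ cJ _ _ _ _) = cJ

  module _ (b : ℕ) (1≤b : 1 ≤ b) where

    singleton-¬⊇-Large : ∀ {x J} → NonEmpty x → NonEmpty J → size J ≡ 1 →
      x ⊆I J → ¬ Large n K P b x
    singleton-¬⊇-Large {x} {J} nx nJ |J|≡1 xJ large =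
      <⇒≱ large (≤-trans (subst (size x ≤_) |J|≡1 (size-mono x J nx nJ xJ)) 1≤b)

    Large-Strong-¬Disjoint-step : ∀ {x J′ J} → Common n K P J → Common n K P J′ →
      J′ ⊆I J → size J ∸ b ≤ size J′ →
      Strong n K P x → Large n K P b x → x ⊆I J → ¬ Disjoint x J′
    Large-Strong-¬Disjoint-step {x} {J′} {J} cJ cJ′ J′J step sx =
      large-⊆-step⇒¬Disjoint b x J′ J
        (Strong⇒NonEmpty sx) (Common⇒NonEmpty cJ′) (Common⇒NonEmpty cJ) J′J step

    Large-Strong-comparable-step : ∀ {x J′ J} → Common n K P J → Common n K P J′ →
      J′ ⊆I J → size J ∸ b ≤ size J′ →
      Strong n K P x → Large n K P b x → x ⊆I J → J′ ⊆I x ⊎ x ⊆I J′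
    Large-Strong-comparable-step {x} {J′} cJ cJ′ J′J step sx large xJ
      with strong-trichotomy x J′ sx cJ′
    ... | inj₁ J′x = inj₁ J′x
    ... | inj₂ (inj₁ xJ′) = inj₂ xJ′
    ... | inj₂ (inj₂ d) =
      ⊥-elim (Large-Strong-¬Disjoint-step cJ cJ′ J′J step sx large xJ d)

    Nested-⊇-Large-Strong⇒Nested : ∀ {J x} → Nested n K P b J →
      Strong n K P x → Large n K P b x → x ⊆I J → Nested n K P b x
    Nested-⊇-Large-Strong⇒Nested (single cJ |J|≡1) sx large xJ =
      ⊥-elim (singleton-¬⊇-Large (Strong⇒NonEmpty sx) (Common⇒NonEmpty cJ) |J|≡1 xJ large)
    Nested-⊇-Large-Strong⇒Nested {J} {x} (grow J′ cJ cJ′ (J′J , _) step nJ′) sx large xJ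
      with Large-Strong-comparable-step cJ cJ′ J′J step sx large xJ
    ... | inj₂ xJ′ = Nested-⊇-Large-Strong⇒Nested nJ′ sx large xJ′
    ... | inj₁ J′x with J′ ≟I x
    ...   | yes refl = nJ′
    ...   | no J′≢x = grow J′ (proj₁ sx) cJ′ (J′x , J′≢x)
            (≤-trans (∸-monoˡ-≤ b |x|≤|J|) step) nJ′
      where
      |x|≤|J| = size-mono x J (Strong⇒NonEmpty sx) (Common⇒NonEmpty cJ) xJ

    Nested-¬⊇-Disjoint-Large-Strong : ∀ {J x y} → Nested n K P b J →
      Strong n K P x → Strong n K P y → Large n K P b x → Large n K P b y →
      x ⊆I J → y ⊆I J → ¬ Disjoint x y
    Nested-¬⊇-Disjoint-Large-Strong (single cJ |J|≡1) sx sy lx ly xJ yJ d =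
      singleton-¬⊇-Large (Strong⇒NonEmpty sx) (Common⇒NonEmpty cJ) |J|≡1 xJ lx
    Nested-¬⊇-Disjoint-Large-Strong {x = x} {y}
      (grow J′ cJ cJ′ (J′J , _) step nJ′) sx sy lx ly xJ yJ d
      with Large-Strong-comparable-step cJ cJ′ J′J step sx lx xJ
         | Large-Strong-comparable-step cJ cJ′ J′J step sy ly yJ
    ... | inj₂ xJ′ | inj₂ yJ′ = Nested-¬⊇-Disjoint-Large-Strong nJ′ sx sy lx ly xJ′ yJ′ d
    ... | inj₁ J′x | _ = Large-Strong-¬Disjoint-step cJ cJ′ J′J step sy ly yJ
          (Disjoint-sym J′ y (Disjoint-⊆ˡ J′ x y J′x d))
    ... | inj₂ _ | inj₁ J′y = Large-Strong-¬Disjoint-step cJ cJ′ J′J step sx lx xJ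
          (Disjoint-sym J′ x (Disjoint-⊆ˡ J′ y x J′y (Disjoint-sym x y d)))

lemma4 : (n K : ℕ) → 1 ≤ n → (hK : 1 ≤ K) → (P : Fin K → Perm n) →
    ((p : Fin n) → Inverse.to (P (fromℕ< hK)) p ≡ p) →
    (b : ℕ) → 1 ≤ b → (I : Interval) →
    QInterval n K P I → Nested n K P b I →
    ((x y : Interval) → InDomain n K P I x → InDomain n K P I y →
    Large n K P b x → Large n K P b y → x ≡ y)
    × ((x : Interval) → InDomain n K P I x → Large n K P b x →
    Common n K P x × Nested n K P b x)
lemma4 n K _ _ P _ b 1≤b I _ nI = atMostOneLarge , largeIsNested
  where
  cI : Common n K P I
  cI = Nested⇒Common n K P nI

  atMostOneLarge : ∀ x y → InDomain n K P I x → InDomain n K P I y →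
    Large n K P b x → Large n K P b y → x ≡ y
  atMostOneLarge x y dx dy lx ly with x ≟I y
  ... | yes x≡y = x≡y
  ... | no x≢y = ⊥-elim (Nested-¬⊇-Disjoint-Large-Strong n K P b 1≤b nI
          (InDomain⇒Strong n K P dx) (InDomain⇒Strong n K P dy) lx ly
          (InDomain⇒⊆I n K P dx) (InDomain⇒⊆I n K P dy)
          (InDomain-Disjoint n K P cI dx dy x≢y))

  largeIsNested : ∀ x → InDomain n K P I x → Large n K P b x →
    Common n K P x × Nested n K P b x
  largeIsNested x dx lx = proj₁ sx ,
    Nested-⊇-Large-Strong⇒Nested n K P b 1≤b nI sx lx (InDomain⇒⊆I n K P dx)
    where sx = InDomain⇒Strong n K P dx
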